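{- For any positive integers $x<y\le z$ with $f(x,y)=f(x,z)$ we have $q(x,y)=q(x,z)$ and, consequently, \[ (q-1)\cdot 2^{f-1}<x\le q\cdot 2^{f-1}<y\le z\le (q+1)\cdot 2^{f-1}\,, \] where $f=f(x,y)=f(x,z)$ and $q=q(x,y)=q(x,z)$.
   Context: For integers $1\le x<y$, $f(x,y)$ denotes the unique positive integer $f$ for which there is an odd positive integer $q$ with $(q-1)\cdot 2^{f-1}<x\le q\cdot 2^{f-1}<y\le (q+1)\cdot 2^{f-1}$ (such $f$ and $q$ exist and are unique); that $q$ is denoted $q(x,y)$. -}

module Defs where

open import Data.Nat using (ℕ; _+_; _*_; _∸_; _^_; _≤_; _<_)
open import Data.Nat.Divisibility using (_∣_)
open import Data.Product using (_×_)
open import Relation.Nullary using (¬_)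

-- odd natural number (hence positive)
Odd : ℕ → Set
Odd q = ¬ (2 ∣ q)

-- For 1 ≤ x < y such f, q exist and are unique; they are f(x,y) and q(x,y).
IsFQ : ℕ → ℕ → ℕ → ℕ → Set
IsFQ x y f q =
  1 ≤ f × Odd q ×
  (q ∸ 1) * 2 ^ (f ∸ 1) < x × x ≤ q * 2 ^ (f ∸ 1) ×
  q * 2 ^ (f ∸ 1) < y × y ≤ (q + 1) * 2 ^ (f ∸ 1)

module Submission where

open import Defs
open import Data.Nat using (ℕ; zero; suc; _+_; _*_; _∸_; _^_; _≤_; _<_; z≤n)
open import Data.Nat.Properties using (*-cancelʳ-<; <-≤-trans; ≤-antisym)
open import Data.Product using (_×_; _,_)
open import Relation.Binary.PropositionalEquality using (_≡_; sym; subst)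

-- The half-open blocks ((q - 1)·P, q·P] of ℕ are pairwise disjoint, so the point x,
-- lying in the block of q and in the block of q′, forces q = q′.

m∸1<n⇒m≤n : ∀ m n → m ∸ 1 < n → m ≤ n
m∸1<n⇒m≤n zero    n _   = z≤n
m∸1<n⇒m≤n (suc m) n m<n = m<n

block-index-≤ : ∀ {x} P m n → (m ∸ 1) * P < x → x ≤ n * P → m ≤ n
block-index-≤ P m n lower upper =
  m∸1<n⇒m≤n m n (*-cancelʳ-< P (m ∸ 1) n (<-≤-trans lower upper))

block-index-unique : ∀ {x} P m n →
  (m ∸ 1) * P < x → x ≤ m * P → (n ∸ 1) * P < x → x ≤ n * P → m ≡ n
block-index-unique P m n m-lower m-upper n-lower n-upper =
  ≤-antisym (block-index-≤ P m n m-lower n-upper) (block-index-≤ P n m n-lower m-upper)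

lemma4p8 : (x y z f q q′ : ℕ) → 1 ≤ x → x < y → y ≤ z →
    IsFQ x y f q → IsFQ x z f q′ →
    q ≡ q′ ×
      ((q ∸ 1) * 2 ^ (f ∸ 1) < x × x ≤ q * 2 ^ (f ∸ 1) ×
       q * 2 ^ (f ∸ 1) < y × y ≤ z × z ≤ (q + 1) * 2 ^ (f ∸ 1))
lemma4p8 x y z f q q′ _ _ y≤z
  (_ , _ , x>[q-1]P , x≤qP , qP<y , _)
  (_ , _ , x>[q′-1]P , x≤q′P , _ , z≤[q′+1]P) =
  q≡q′ , x>[q-1]P , x≤qP , qP<y , y≤z , z≤[q+1]P
  where
  P = 2 ^ (f ∸ 1)
  q≡q′ : q ≡ q′
  q≡q′ = block-index-unique P q q′ x>[q-1]P x≤qP x>[q′-1]P x≤q′P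
  z≤[q+1]P : z ≤ (q + 1) * P
  z≤[q+1]P = subst (λ r → z ≤ (r + 1) * P) (sym q≡q′) z≤[q′+1]P
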